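{- Let $\Sigma$ be a finite set and let $\mathcal{RE}$ be the family of recursively enumerable safety constraints, i.e. of all sets $\mathcal C_\Omega(P)$ where $P$ is a recursively enumerable prefix-free subset of $\Sigma^+$. Then $\mathcal{RE}$ is a family with a universal detector: there exists a $\Sigma$-detector $b$ with carrier $B$ such that $\mathcal{RE}=\{\mathcal C_b(y)\mid y\in B\}$.
   Context: $\Sigma^{\mathbb N}$ is the set of streams over $\Sigma$, $\Sigma^+$ the set of nonempty finite words, $|u|$ length, $u[0:m]$ the prefix of length $m$, $s[m:]$ the sequence $k\mapsto s(k+m)$; $\mathbf 1=\{\Downarrow\}$, $+$ disjoint union. $P\subseteq\Sigma^+$ is prefix-free if $u\in P$ implies $u[0:m]\notin P$ for $0\le m<|u|$; $n^{ -1}\cdot P=\{u\mid nu\in P\}$. A $\Sigma$-detector is a map $a:A\to(\mathbf 1+A)^\Sigma$. $\Omega$ is the detector on the set of all prefix-free subsets of $\Sigma^+$ with $\Omega(P)(n)=\Downarrow$ if $n\in P$ and $n^{ -1}\cdot P$ otherwise. For a stream $s$, $[s]$ is the system with state set $\{s[k:]\mid k\in\mathbb N\}$, output $t\mapsto t(0)$, transition $t\mapsto t[1:]$. For such a system $\sigma=\langle\mathrm{out}_\sigma,\mathrm{tr}_\sigma\rangle$ and a detector $a$, $\mathrm{Join}(\sigma,a)(x,y)=\Downarrow$ if $a(y)(\mathrm{out}_\sigma x)=\Downarrow$ and $(\mathrm{tr}_\sigma x,a(y)(\mathrm{out}_\sigma x))$ otherwise. Iterates of $g:G\to\mathbf 1+G$: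 $g^{(1)}=g$, $g^{(k+1)}(x)=\Downarrow$ if $g^{(k)}(x)=\Downarrow$, else $g(g^{(k)}(x))$. $\mathcal C_a(x)=\{s\in\Sigma^{\mathbb N}\mid \mathrm{Join}([s],a)^{(k)}(s,x)\ne\Downarrow\text{ for all }k\ge1\}$. -}

module Defs where

open import Level using (Level; 0ℓ) renaming (suc to lsuc)
open import Data.Nat using (ℕ; zero; suc; _+_; _*_; _<_; _≤_; s≤s)
open import Data.Fin using (Fin; toℕ)
open import Data.Vec using (Vec; []; _∷_; lookup)
open import Data.List using (List; []; _∷_; length; take)
open import Data.Unit using (⊤; tt)
open import Data.Sum using (_⊎_; inj₁; inj₂)
open import Data.Product using (Σ; Σ-syntax; ∃; ∃-syntax; _×_; _,_; proj₁; proj₂)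
open import Relation.Nullary using (¬_; Dec; yes; no)
open import Relation.Binary.PropositionalEquality using (_≡_; _≢_)
open import Function.Bundles using (_⇔_)
open import Axiom.ExcludedMiddle using (ExcludedMiddle)

-- Alphabet: a finite set Σ is represented by Fin k.
-- Streams, words, suffixes.

Stream : Set → Set
Stream A = ℕ → A

suffix : {A : Set} → Stream A → ℕ → Stream A
suffix s m = λ k → s (k + m)

⇓ : ∀ {a} {X : Set a} → ⊤ ⊎ X
⇓ = inj₁ tt

Detector : ∀ {a} → Set → Set a → Set a
Detector Letter A = A → Letter → ⊤ ⊎ A

-- The stream system [s] : output t ↦ t(0), transition t ↦ t[1:]
-- (defined on all streams; [s] only visits the suffixes of s).
out : {L : Set} → Stream L → L
out t = t 0

tr : {L : Set} → Stream L → Stream L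
tr t = suffix t 1

Join : ∀ {a} {L : Set} {A : Set a} → Detector L A →
       Stream L × A → ⊤ ⊎ (Stream L × A)
Join a (x , y) with a y (out x)
... | inj₁ _  = ⇓
... | inj₂ y' = inj₂ (tr x , y')

-- Iterates g^(k); iter g 0 is the identity (only k ≥ 1 is used).
iter : ∀ {a} {G : Set a} → (G → ⊤ ⊎ G) → ℕ → G → ⊤ ⊎ G
iter g zero x = inj₂ x
iter g (suc zero) x = g x
iter g (suc (suc k)) x with iter g (suc k) x
... | inj₁ _ = ⇓
... | inj₂ z = g z

C : ∀ {a} {L : Set} {A : Set a} → Detector L A → A → Stream L → Set a
C a x s = ∀ k → 1 ≤ k → iter (Join a) k (s , x) ≢ ⇓

-- Prefix-free subsets of Σ⁺ (words are lists; subsets of Σ⁺ are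
-- predicates on lists not containing the empty word).

PrefixFree : {L : Set} → (List L → Set) → Set
PrefixFree P = ∀ u → P u → ∀ m → m < length u → ¬ P (take m u)

PF : Set → Set₁
PF L = Σ[ P ∈ (List L → Set) ] (¬ P []) × PrefixFree P

-- The detector Ω (membership n ∈ P is decided classically).
Ω : {L : Set} → ExcludedMiddle 0ℓ → Detector L (PF L)
Ω lem (P , ne , pf) c with lem {P (c ∷ [])}
... | yes _  = ⇓
... | no ¬p  = inj₂ ((λ u → P (c ∷ u)) , ¬p ,
                     λ u h m lt → pf (c ∷ u) h (suc m) (s≤s lt))

-- Computability: partial (μ-)recursive functions with a big-step
-- evaluation relation.

data PRF : ℕ → Set where
  Z    : ∀ {k} → PRF k
  S    : PRF 1
  π    : ∀ {k} → Fin k → PRF k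
  comp : ∀ {k m} → PRF m → Vec (PRF k) m → PRF k
  prec : ∀ {k} → PRF k → PRF (suc (suc k)) → PRF (suc k)
  mu   : ∀ {k} → PRF (suc k) → PRF k

mutual
  data _·_⇓_ : ∀ {k} → PRF k → Vec ℕ k → ℕ → Set where
    Z⇓    : ∀ {k} {xs : Vec ℕ k} → Z · xs ⇓ 0
    S⇓    : ∀ {x} → S · (x ∷ []) ⇓ suc x
    π⇓    : ∀ {k} {i : Fin k} {xs} → π i · xs ⇓ lookup xs i
    comp⇓ : ∀ {k m} {g : PRF m} {hs : Vec (PRF k) m} {xs ys v} →
            hs ·s xs ⇓ ys → g · ys ⇓ v → comp g hs · xs ⇓ v
    prec0 : ∀ {k} {f : PRF k} {g} {xs v} →
            f · xs ⇓ v → prec f g · (0 ∷ xs) ⇓ v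
    precS : ∀ {k} {f : PRF k} {g} {n xs r v} →
            prec f g · (n ∷ xs) ⇓ r → g · (n ∷ r ∷ xs) ⇓ v →
            prec f g · (suc n ∷ xs) ⇓ v
    mu⇓   : ∀ {k} {f : PRF (suc k)} {xs n} →
            f · (n ∷ xs) ⇓ 0 →
            (∀ m → m < n → Σ ℕ λ r → f · (m ∷ xs) ⇓ suc r) →
            mu f · xs ⇓ n

  data _·s_⇓_ : ∀ {k m} → Vec (PRF k) m → Vec ℕ k → Vec ℕ m → Set where
    []⇓ : ∀ {k} {xs : Vec ℕ k} → [] ·s xs ⇓ []
    ∷⇓  : ∀ {k m} {h : PRF k} {hs : Vec (PRF k) m} {xs y ys} →
          h · xs ⇓ y → hs ·s xs ⇓ ys → (h ∷ hs) ·s xs ⇓ (y ∷ ys)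

Halts : PRF 1 → ℕ → Set
Halts f x = ∃[ v ] f · (x ∷ []) ⇓ v

-- Coding of words over Fin k as naturals (bijective base-k numeration).
encode : ∀ {k} → List (Fin k) → ℕ
encode {k} [] = 0
encode {k} (c ∷ w) = suc (toℕ c) + k * encode w

RE : ∀ {k} → (List (Fin k) → Set) → Set
RE P = ∃[ f ] (∀ w → P w ⇔ Halts f (encode w))

_≐_ : ∀ {a b} {L : Set} → (Stream L → Set a) → (Stream L → Set b) → Set (a Level.⊔ b)
X ≐ Y = ∀ s → X s ⇔ Y s

module Submission where

-- States of two detectors related by a bisimulation (related
-- states halt on the same letters and otherwise move to related states)
-- define the same safety constraint.  The universal detector is the part
-- of Ω spanned by the recursively enumerable prefix-free languages, each
-- represented by a partial recursive function whose domain it is (this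
-- keeps the state set in Set, whereas Ω lives on PF Σ : Set₁).  Its
-- transitions exist because r.e. languages are closed under left
-- quotients: precomposing f with x ↦ (c + 1) + k·x yields a code of
-- c⁻¹·(Dom f), by the bijective base-k coding of words.

open import Defs
open import Level using (Level; 0ℓ; _⊔_)
open import Data.Nat using (ℕ; zero; suc; _+_; _*_; s≤s)
open import Data.Nat.Properties using (<-cmp)
open import Data.Fin using (Fin; toℕ; zero; suc)
open import Data.Vec using (Vec; []; _∷_)
open import Data.List using (List; []; _∷_)
open import Data.Unit using (⊤)
open import Data.Empty using (⊥-elim)
open import Data.Sum using (_⊎_; inj₁; inj₂)
open import Data.Sum.Relation.Binary.Pointwise using (Pointwise; inj₁; inj₂)
open import Data.Product using (Σ-syntax; ∃-syntax; _×_; _,_; proj₁; proj₂)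
open import Relation.Nullary using (¬_; yes; no)
open import Relation.Binary.Core using (REL)
open import Relation.Binary.Definitions using (tri<; tri≈; tri>)
open import Relation.Binary.PropositionalEquality using (_≡_; refl; cong₂; subst)
open import Function.Base using (_∘_)
open import Function.Bundles using (_⇔_; mk⇔; Equivalence)
open import Function.Construct.Composition using (_⇔-∘_)
open import Function.Construct.Symmetry using (⇔-sym)
open import Function.Construct.Identity using (⇔-id)
open import Axiom.ExcludedMiddle using (ExcludedMiddle)

open Equivalence using (to; from)

private
  variable
    ℓ ℓ′ ℓ″ : Level
    L : Set

Agree : {X : Set ℓ} {Y : Set ℓ′} → REL X Y ℓ″ → ⊤ ⊎ X → ⊤ ⊎ Y → Set (ℓ ⊔ ℓ′ ⊔ ℓ″)
Agree R = Pointwise _≡_ R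

agree-halts : {X : Set ℓ} {Y : Set ℓ′} {R : REL X Y ℓ″} {t : ⊤ ⊎ X} {t′ : ⊤ ⊎ Y} →
              Agree R t t′ → (t ≡ ⇓) ⇔ (t′ ≡ ⇓)
agree-halts (inj₁ refl) = mk⇔ (λ _ → refl) (λ _ → refl)
agree-halts (inj₂ _)    = mk⇔ (λ ()) (λ ())

iter-agree : {G : Set ℓ} {G′ : Set ℓ′} (R : REL G G′ ℓ″)
             {g : G → ⊤ ⊎ G} {g′ : G′ → ⊤ ⊎ G′} →
             (∀ {x x′} → R x x′ → Agree R (g x) (g′ x′)) →
             ∀ k {x x′} → R x x′ → Agree R (iter g k x) (iter g′ k x′)
iter-agree R step zero          r = inj₂ r
iter-agree R step (suc zero)    r = step r
iter-agree R {g} {g′} step (suc (suc k)) {x} {x′} r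
  with iter g (suc k) x | iter g′ (suc k) x′ | iter-agree R step (suc k) r
... | inj₁ _ | inj₁ _ | inj₁ _  = inj₁ refl
... | inj₂ _ | inj₂ _ | inj₂ r′ = step r′

IsBisimulation : {B : Set ℓ} {A : Set ℓ′} →
                 Detector L B → Detector L A → REL B A ℓ″ → Set (ℓ ⊔ ℓ′ ⊔ ℓ″)
IsBisimulation b a R = ∀ {y x} → R y x → ∀ c → Agree R (b y c) (a x c)

JoinRel : {B : Set ℓ} {A : Set ℓ′} → REL B A ℓ″ →
          REL (Stream L × B) (Stream L × A) ℓ″
JoinRel R (s , y) (t , x) = s ≡ t × R y x

join-agree : {B : Set ℓ} {A : Set ℓ′} {b : Detector L B} {a : Detector L A}
             {R : REL B A ℓ″} → IsBisimulation b a R →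
             ∀ {p q} → JoinRel R p q → Agree (JoinRel R) (Join b p) (Join a q)
join-agree {b = b} {a} bis {s , y} {.s , x} (refl , r)
  with b y (out s) | a x (out s) | bis r (out s)
... | inj₁ _ | inj₁ _ | inj₁ _  = inj₁ refl
... | inj₂ _ | inj₂ _ | inj₂ r′ = inj₂ (refl , r′)

C-bisim : {B : Set ℓ} {A : Set ℓ′} {b : Detector L B} {a : Detector L A}
          {R : REL B A ℓ″} → IsBisimulation b a R →
          ∀ {y x} → R y x → C b y ≐ C a x
C-bisim {b = b} {a} {R} bis {y} {x} r s =
  mk⇔ (λ safe k k≥1 → safe k k≥1 ∘ from (halts-together k))
      (λ safe k k≥1 → safe k k≥1 ∘ to (halts-together k))
  where
  halts-together : ∀ k → (iter (Join b) k (s , y) ≡ ⇓) ⇔ (iter (Join a) k (s , x) ≡ ⇓)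
  halts-together k = agree-halts (iter-agree (JoinRel R) (join-agree bis) k (refl , r))

mutual
  eval-det : ∀ {n} {f : PRF n} {xs u v} → f · xs ⇓ u → f · xs ⇓ v → u ≡ v
  eval-det Z⇓ Z⇓ = refl
  eval-det S⇓ S⇓ = refl
  eval-det π⇓ π⇓ = refl
  eval-det (comp⇓ hs g) (comp⇓ hs′ g′) with evals-det hs hs′
  ... | refl = eval-det g g′
  eval-det (prec0 d) (prec0 d′) = eval-det d d′
  eval-det (precS d e) (precS d′ e′) with eval-det d d′
  ... | refl = eval-det e e′
  -- Two candidate least zeros: the smaller one would be a non-zero
  -- value below the larger one.
  eval-det (mu⇓ {n = n} z below) (mu⇓ {n = n′} z′ below′) with <-cmp n n′
  ... | tri≈ _ n≡n′ _ = n≡n′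
  ... | tri< n<n′ _ _ with eval-det z (proj₂ (below′ n n<n′))
  ...   | ()
  eval-det (mu⇓ {n = n} z below) (mu⇓ {n = n′} z′ below′) | tri> _ _ n′<n
    with eval-det z′ (proj₂ (below n′ n′<n))
  ... | ()

  evals-det : ∀ {n m} {hs : Vec (PRF n) m} {xs ys ys′} →
              hs ·s xs ⇓ ys → hs ·s xs ⇓ ys′ → ys ≡ ys′
  evals-det []⇓ []⇓ = refl
  evals-det (∷⇓ d ds) (∷⇓ d′ ds′) = cong₂ _∷_ (eval-det d d′) (evals-det ds ds′)

const : ∀ {n} → ℕ → PRF n
const zero    = Z
const (suc m) = comp S (const m ∷ [])

const-eval : ∀ {n} m {xs : Vec ℕ n} → const m · xs ⇓ m
const-eval zero    = Z⇓
const-eval (suc m) = comp⇓ (∷⇓ (const-eval m) []⇓) S⇓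

add : PRF 2
add = prec (π zero) (comp S (π (suc zero) ∷ []))

add-eval : ∀ x y → add · (x ∷ y ∷ []) ⇓ (x + y)
add-eval zero    y = prec0 π⇓
add-eval (suc x) y = precS (add-eval x y) (comp⇓ (∷⇓ π⇓ []⇓) S⇓)

mul : PRF 2
mul = prec Z (comp add (π (suc (suc zero)) ∷ π (suc zero) ∷ []))

mul-eval : ∀ x y → mul · (x ∷ y ∷ []) ⇓ (x * y)
mul-eval zero    y = prec0 Z⇓
mul-eval (suc x) y =
  precS (mul-eval x y) (comp⇓ (∷⇓ π⇓ (∷⇓ π⇓ []⇓)) (add-eval y (x * y)))

affine : ℕ → ℕ → PRF 1
affine a m = comp add (const a ∷ comp mul (const m ∷ π zero ∷ []) ∷ [])

affine-eval : ∀ a m x → affine a m · (x ∷ []) ⇓ (a + m * x)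
affine-eval a m x =
  comp⇓ (∷⇓ (const-eval a) (∷⇓ mul-step []⇓)) (add-eval a (m * x))
  where
  mul-step : comp mul (const m ∷ π zero ∷ []) · (x ∷ []) ⇓ (m * x)
  mul-step = comp⇓ (∷⇓ (const-eval m) (∷⇓ π⇓ []⇓)) (mul-eval m x)

halts-affine : ∀ f a m x → Halts (comp f (affine a m ∷ [])) x ⇔ Halts f (a + m * x)
halts-affine f a m x = mk⇔
  (λ { (v , comp⇓ (∷⇓ d []⇓) e) →
         v , subst (λ y → f · (y ∷ []) ⇓ v) (eval-det d (affine-eval a m x)) e })
  (λ { (v , e) → v , comp⇓ (∷⇓ (affine-eval a m x) []⇓) e })

Dom : ∀ {k} → PRF 1 → List (Fin k) → Set
Dom f w = Halts f (encode w)

-- A code for the left quotient c⁻¹·Dom f: since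
-- encode (c ∷ u) = (c + 1) + k · encode u, substitute this affine map.
quotient : ∀ k → PRF 1 → Fin k → PRF 1
quotient k f c = comp f (affine (suc (toℕ c)) k ∷ [])

dom-quotient : ∀ {k} f (c : Fin k) u → Dom (quotient k f c) u ⇔ Dom f (c ∷ u)
dom-quotient {k} f c u = halts-affine f (suc (toℕ c)) k (encode u)

prefixFree-resp : {P Q : List L → Set} → (∀ w → P w ⇔ Q w) →
                  PrefixFree P → PrefixFree Q
prefixFree-resp P⇔Q pf u q m m<|u| q′ =
  pf u (from (P⇔Q u) q) m m<|u| (from (P⇔Q _) q′)

prefixFree-quotient : {P : List L → Set} → PrefixFree P →
                      ∀ c → PrefixFree (λ u → P (c ∷ u))
prefixFree-quotient pf c u p m m<|u| = pf (c ∷ u) p (suc m) (s≤s m<|u|)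

Code : ℕ → Set
Code k = Σ[ f ∈ PRF 1 ] (¬ Dom {k} f [] × PrefixFree (Dom {k} f))

universal : ∀ k → ExcludedMiddle 0ℓ → Detector (Fin k) (Code k)
universal k lem (f , ε∉f , pf) c with lem {Dom f (c ∷ [])}
... | yes _  = ⇓
... | no c∉f = inj₂ (quotient k f c , c∉f ∘ to (dom-quotient f c []) ,
                     prefixFree-resp (λ u → ⇔-sym (dom-quotient f c u))
                                     (prefixFree-quotient pf c))

Denotes : ∀ {k} → Code k → PF (Fin k) → Set
Denotes (f , _) (P , _) = ∀ w → Dom f w ⇔ P w

denotes-bisim : ∀ {k} (lem : ExcludedMiddle 0ℓ) →
                IsBisimulation (universal k lem) (Ω lem) Denotes
denotes-bisim lem {f , _} {P , _} f≡P c with lem {Dom f (c ∷ [])} | lem {P (c ∷ [])}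
... | yes _  | yes _  = inj₁ refl
... | no _   | no _   = inj₂ (λ u → f≡P (c ∷ u) ⇔-∘ dom-quotient f c u)
... | yes c∈f | no c∉P = ⊥-elim (c∉P (to (f≡P _) c∈f))
... | no c∉f | yes c∈P = ⊥-elim (c∉f (from (f≡P _) c∈P))

denotes-C : ∀ {k} (lem : ExcludedMiddle 0ℓ) {y : Code k} {P : PF (Fin k)} →
            Denotes y P → C (universal k lem) y ≐ C (Ω lem) P
denotes-C lem = C-bisim (λ {y} {x} → denotes-bisim lem {y} {x})

code-of-RE : ∀ {k} (P : PF (Fin k)) → RE (proj₁ P) → Σ[ y ∈ Code k ] Denotes y P
code-of-RE (P , ε∉P , pf) (f , P⇔f) =
  (f , ε∉P ∘ from (P⇔f []) , prefixFree-resp P⇔f pf) , (λ w → ⇔-sym (P⇔f w))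

language-of-code : ∀ {k} (y : Code k) →
                   Σ[ P ∈ PF (Fin k) ] (RE (proj₁ P) × Denotes y P)
language-of-code (f , ε∉f , pf) =
  (Dom f , ε∉f , pf) , (f , λ w → ⇔-id _) , (λ w → ⇔-id _)

theorem8 : (k : ℕ) → (lem : ExcludedMiddle 0ℓ) →
    Σ[ B ∈ Set ] Σ[ b ∈ Detector (Fin k) B ]
      ((∀ (P : PF (Fin k)) → RE (proj₁ P) → ∃[ y ] (C b y ≐ C (Ω lem) P))
       × (∀ (y : B) → Σ[ P ∈ PF (Fin k) ] (RE (proj₁ P) × (C b y ≐ C (Ω lem) P))))
theorem8 k lem = Code k , universal k lem , every-RE-constraint , every-state-RE
  where
  every-RE-constraint : ∀ (P : PF (Fin k)) → RE (proj₁ P) →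
                        ∃[ y ] (C (universal k lem) y ≐ C (Ω lem) P)
  every-RE-constraint P re with code-of-RE P re
  ... | y , y≡P = y , denotes-C lem y≡P

  every-state-RE : ∀ (y : Code k) → Σ[ P ∈ PF (Fin k) ]
                     (RE (proj₁ P) × (C (universal k lem) y ≐ C (Ω lem) P))
  every-state-RE y with language-of-code y
  ... | P , re , y≡P = P , re , denotes-C lem y≡P
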